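{- For every integer $k\ge1$ and every integer $t\ge0$, the number of independent dominating sets of size $k$ of the path $P_{k+t}$ is \[d_i(P_{k+t},k)=\binom{k+1}{t-k+1}.\]
   Context: $P_m$ is the path on $m$ vertices. A set $S$ of vertices is an independent dominating set if no two vertices of $S$ are adjacent and every vertex outside $S$ has a neighbour in $S$; $d_i(G,k)$ is the number of independent dominating sets of $G$ of size $k$. Binomial coefficients $\binom{a}{b}$ are taken to be $0$ when $b<0$ or $b>a$. -}

module Defs where

open import Data.Nat using (ℕ; zero; suc; _+_; _≟_)
open import Data.Nat.Combinatorics using (_C_)
open import Data.Integer using (ℤ; +_; -[1+_])
open import Data.Fin using (Fin; toℕ)
open import Data.Fin.Subset using (Subset; _∈_; _∉_; ∣_∣)
open import Data.Fin.Subset.Properties using (_∈?_)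
open import Data.Vec using (Vec; []; _∷_)
open import Data.Bool using (Bool; true; false)
open import Data.List using (List; []; _∷_; map; _++_; length; filter)
open import Data.Product using (_×_; ∃; _,_)
open import Data.Sum using (_⊎_)
open import Relation.Nullary using (¬_; Dec; yes; no)
open import Relation.Nullary.Decidable using (_×-dec_; _⊎-dec_; ¬?)
open import Relation.Binary.PropositionalEquality using (_≡_)
open import Data.Fin.Properties using (all?; any?)

PathAdj : (m : ℕ) → Fin m → Fin m → Set
PathAdj m i j = (suc (toℕ i) ≡ toℕ j) ⊎ (suc (toℕ j) ≡ toℕ i)

pathAdj? : (m : ℕ) → (i j : Fin m) → Dec (PathAdj m i j)
pathAdj? m i j = (suc (toℕ i) ≟ toℕ j) ⊎-dec (suc (toℕ j) ≟ toℕ i)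

Independent : (m : ℕ) → Subset m → Set
Independent m S = ∀ i j → i ∈ S → j ∈ S → ¬ PathAdj m i j

Dominating : (m : ℕ) → Subset m → Set
Dominating m S = ∀ i → i ∉ S → ∃ λ j → j ∈ S × PathAdj m i j

IndependentDominating : (m : ℕ) → Subset m → Set
IndependentDominating m S = Independent m S × Dominating m S

independent? : (m : ℕ) → (S : Subset m) → Dec (Independent m S)
independent? m S =
  all? λ i → all? λ j →
    helper (i ∈? S) (j ∈? S) (pathAdj? m i j)
  where
  helper : ∀ {A B C : Set} → Dec A → Dec B → Dec C → Dec (A → B → ¬ C)
  helper _ _ (no ¬c) = yes λ _ _ c → ¬c c
  helper (no ¬a) _ (yes _) = yes λ a → Data.Empty.⊥-elim (¬a a)
    where import Data.Empty
  helper (yes a) (no ¬b) (yes _) = yes λ _ b → Data.Empty.⊥-elim (¬b b)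
    where import Data.Empty
  helper (yes a) (yes b) (yes c) = no λ f → f a b c

dominating? : (m : ℕ) → (S : Subset m) → Dec (Dominating m S)
dominating? m S = all? λ i → imp (i ∈? S) (any? λ j → (j ∈? S) ×-dec pathAdj? m i j)
  where
  imp : ∀ {A B : Set} → Dec A → Dec B → Dec (¬ A → B)
  imp _ (yes b) = yes λ _ → b
  imp (yes a) (no _) = yes λ na → Data.Empty.⊥-elim (na a)
    where import Data.Empty
  imp (no na) (no nb) = no λ f → nb (f na)

allSubsets : (m : ℕ) → List (Subset m)
allSubsets zero = [] ∷ []
allSubsets (suc m) = map (true ∷_) (allSubsets m) ++ map (false ∷_) (allSubsets m)

dᵢ-path : (m k : ℕ) → ℕ
dᵢ-path m k = length (filter (λ S → (independent? m S ×-dec dominating? m S) ×-dec (∣ S ∣ ≟ k)) (allSubsets m))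

-- Binomial coefficient with integer lower index; 0 when the lower index is negative
-- (and, via stdlib's _C_, 0 when it exceeds the upper index).
binomℤ : ℕ → ℤ → ℕ
binomℤ a (+ b) = a C b
binomℤ a -[1+ _ ] = 0

module Submission where

-- Look at the first vertex of P_m.  If it is chosen, the second
-- vertex is not chosen (independence) and is dominated by the first, so the
-- rest is an arbitrary independent dominating set of P_(m-2).  If it is not
-- chosen, it must be dominated, so the second vertex is chosen, and the rest
-- is an independent dominating set of P_(m-1) containing its first vertex.
-- Splitting the count by the first vertex therefore gives two counting
-- sequences, withFirst and withoutFirst, that are linked to d_i by a
-- simultaneous recurrence; solving it with Pascal's rule yields the closed
-- form  d_i(P_m, k) = C(k+1, m+1-2k)  for ALL m and k.  The theorem is the
-- case m = k + t.

open import Defs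
open import Data.Nat using (ℕ; suc; _+_; _≤_)
open import Data.Integer using (+_; _-_) renaming (_+_ to _+ℤ_)
open import Relation.Binary.PropositionalEquality using (_≡_)

open import Data.Nat using (zero; _≟_)
open import Data.Nat.Properties using (suc-injective; +-comm; +-suc; +-identityʳ)
open import Data.Nat.Combinatorics using (_C_; nCk+nC[k+1]≡[n+1]C[k+1])
open import Data.Integer using (_⊖_)
open import Data.Integer.Properties
  using ([1+m]⊖[1+n]≡m⊖n; +-cancelˡ-⊖; m-n≡m⊖n; distribˡ-⊖-+-pos)
open import Data.Fin using (Fin; zero; suc; toℕ)
open import Data.Fin.Subset using (Subset; _∈_; _∉_; ∣_∣)
open import Data.Vec using (_∷_; here; there)
open import Data.Bool using (true; false)
open import Data.List using (List; []; _∷_; _++_; map; length; filter)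
open import Data.List.Properties using (filter-++; length-++; filter-≐; filter-none)
open import Data.List.Relation.Unary.All as All using ()
open import Data.Product using (_×_; ∃; _,_)
open import Data.Sum using (_⊎_; inj₁; inj₂)
open import Relation.Nullary using (¬_; does)
open import Relation.Nullary.Decidable using (_×-dec_)
open import Relation.Unary using (Decidable; _≐_)
open import Relation.Binary.PropositionalEquality
  using (refl; sym; trans; cong; cong₂; module ≡-Reasoning)
open import Function using (_∘_)
open import Function.Bundles using (_⇔_; mk⇔; Equivalence)

#subsets : ∀ {m} {P : Subset m → Set} → Decidable P → ℕ
#subsets {m} P? = length (filter P? (allSubsets m))

length-filter-map : ∀ {A B : Set} {P : B → Set} (P? : Decidable P) (f : A → B) →
  ∀ xs →
  length (filter P? (map f xs)) ≡ length (filter (P? ∘ f) xs)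
length-filter-map P? f [] = refl
length-filter-map P? f (x ∷ xs) with does (P? (f x))
... | true  = cong suc (length-filter-map P? f xs)
... | false = length-filter-map P? f xs

#subsets-split : ∀ {m} {P : Subset (suc m) → Set} (P? : Decidable P) →
  #subsets P? ≡ #subsets (P? ∘ (true ∷_)) + #subsets (P? ∘ (false ∷_))
#subsets-split {m} P? = begin
  length (filter P? (with0 ++ without0))
    ≡⟨ cong length (filter-++ P? with0 without0) ⟩
  length (filter P? with0 ++ filter P? without0)
    ≡⟨ length-++ (filter P? with0) ⟩
  length (filter P? with0) + length (filter P? without0)
    ≡⟨ cong₂ _+_ (length-filter-map P? (true ∷_) (allSubsets m)) refl ⟩
  #subsets (P? ∘ (true ∷_)) + length (filter P? without0)
    ≡⟨ cong₂ _+_ refl (length-filter-map P? (false ∷_) (allSubsets m)) ⟩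
  #subsets (P? ∘ (true ∷_)) + #subsets (P? ∘ (false ∷_)) ∎
  where
  open ≡-Reasoning
  with0 without0 : List (Subset (suc m))
  with0    = map (true ∷_) (allSubsets m)
  without0 = map (false ∷_) (allSubsets m)

#subsets-cong : ∀ {m} {P Q : Subset m → Set} (P? : Decidable P) (Q? : Decidable Q) →
  P ≐ Q → #subsets P? ≡ #subsets Q?
#subsets-cong {m} P? Q? P≐Q = cong length (filter-≐ P? Q? P≐Q (allSubsets m))

#subsets-none : ∀ {m} {P : Subset m → Set} (P? : Decidable P) →
  (∀ S → ¬ P S) → #subsets P? ≡ 0
#subsets-none {m} P? ¬P =
  cong length (filter-none P? {allSubsets m} (All.tabulate (λ {S} _ → ¬P S)))

Dominated : (m : ℕ) → Subset m → Fin m → Set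
Dominated m S i = ∃ λ j → j ∈ S × PathAdj m i j

adj-suc : ∀ {m} {i j : Fin m} → PathAdj m i j → PathAdj (suc m) (suc i) (suc j)
adj-suc (inj₁ e) = inj₁ (cong suc e)
adj-suc (inj₂ e) = inj₂ (cong suc e)

adj-pred : ∀ {m} {i j : Fin m} → PathAdj (suc m) (suc i) (suc j) → PathAdj m i j
adj-pred (inj₁ e) = inj₁ (suc-injective e)
adj-pred (inj₂ e) = inj₂ (suc-injective e)

adj-sym : ∀ {m} {i j : Fin m} → PathAdj m i j → PathAdj m j i
adj-sym (inj₁ e) = inj₂ e
adj-sym (inj₂ e) = inj₁ e

independent-tail : ∀ {m b} {S : Subset m} → Independent (suc m) (b ∷ S) → Independent m S
independent-tail ind i j i∈ j∈ adj = ind (suc i) (suc j) (there i∈) (there j∈) (adj-suc adj)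

independent-out : ∀ {m} {S : Subset m} → Independent m S → Independent (suc m) (false ∷ S)
independent-out ind zero _ () _ _
independent-out ind (suc i) zero _ () _
independent-out ind (suc i) (suc j) (there i∈) (there j∈) adj = ind i j i∈ j∈ (adj-pred adj)

-- Prepending a chosen vertex keeps a set independent provided its old first
-- vertex (the only new neighbour) is unchosen.
independent-in : ∀ {m} {S : Subset (suc m)} → Independent (suc m) S → zero ∉ S →
  Independent (suc (suc m)) (true ∷ S)
independent-in {m} {S} ind 0∉ = λ
  { zero    zero    _ _ (inj₁ ()) ; zero zero _ _ (inj₂ ())
  ; zero    (suc j) _ j∈ adj → first-free j j∈ adj
  ; (suc i) zero    i∈ _ adj → first-free i i∈ (adj-sym adj)
  ; (suc i) (suc j) (there i∈) (there j∈) adj → ind i j i∈ j∈ (adj-pred adj) }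
  where
  first-free : ∀ j → suc j ∈ true ∷ S → ¬ PathAdj (suc (suc m)) zero (suc j)
  first-free zero (there j∈) _ = 0∉ j∈
  first-free (suc j) _ (inj₁ ())
  first-free (suc j) _ (inj₂ ())

dominated-suc : ∀ {m b} {S : Subset m} {i} →
  Dominated m S i → Dominated (suc m) (b ∷ S) (suc i)
dominated-suc (j , j∈ , adj) = suc j , there j∈ , adj-suc adj

dominated-pred : ∀ {m b} {S : Subset m} {i} → Dominated (suc m) (b ∷ S) (suc i) →
  Dominated m S i ⊎ (b ≡ true × toℕ i ≡ 0)
dominated-pred (zero , here , inj₁ ())
dominated-pred (zero , here , inj₂ e) = inj₂ (refl , suc-injective (sym e))
dominated-pred (suc j , there j∈ , adj) = inj₁ (j , j∈ , adj-pred adj)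

dominated-pred-out : ∀ {m} {S : Subset m} {i} →
  Dominated (suc m) (false ∷ S) (suc i) → Dominated m S i
dominated-pred-out d with dominated-pred d
... | inj₁ d′ = d′
... | inj₂ (() , _)

dominated-pred-far : ∀ {m b} {S : Subset (suc m)} {i : Fin m} →
  Dominated (suc (suc m)) (b ∷ S) (suc (suc i)) → Dominated (suc m) S (suc i)
dominated-pred-far d with dominated-pred d
... | inj₁ d′ = d′
... | inj₂ (_ , ())

module _ {m : ℕ} {S : Subset m} where

  ¬both-first-two : ¬ Independent (suc (suc m)) (true ∷ true ∷ S)
  ¬both-first-two ind = ind zero (suc zero) here (there here) (inj₁ refl)

  -- If neither of the first two vertices is chosen, vertex 0 is undominated.
  ¬neither-first-two : ¬ Dominating (suc (suc m)) (false ∷ false ∷ S)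
  ¬neither-first-two dom with dom zero (λ ())
  ... | zero , () , _
  ... | suc zero , there () , _
  ... | suc (suc _) , _ , inj₁ ()
  ... | suc (suc _) , _ , inj₂ ()

  first-chosen : IndependentDominating (suc (suc m)) (true ∷ false ∷ S) ⇔
                 IndependentDominating m S
  first-chosen = mk⇔ to from
    where
    to : IndependentDominating (suc (suc m)) (true ∷ false ∷ S) → IndependentDominating m S
    to (ind , dom) = independent-tail (independent-tail ind) , dom′
      where
      dom′ : Dominating m S
      dom′ i i∉ = dominated-pred-out (dominated-pred-far
                    (dom (suc (suc i)) λ { (there (there i∈)) → i∉ i∈ }))
    from : IndependentDominating m S → IndependentDominating (suc (suc m)) (true ∷ false ∷ S)
    from (ind , dom) = independent-in (independent-out ind) (λ ()) , dom′
      where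
      dom′ : Dominating (suc (suc m)) (true ∷ false ∷ S)
      dom′ zero 0∉ with () ← 0∉ here
      dom′ (suc zero) _ = zero , here , inj₂ refl
      dom′ (suc (suc i)) i∉ =
        dominated-suc (dominated-suc (dom i λ i∈ → i∉ (there (there i∈))))

  first-omitted : IndependentDominating (suc (suc m)) (false ∷ true ∷ S) ⇔
                  IndependentDominating (suc m) (true ∷ S)
  first-omitted = mk⇔ to from
    where
    to : IndependentDominating (suc (suc m)) (false ∷ true ∷ S) →
         IndependentDominating (suc m) (true ∷ S)
    to (ind , dom) = independent-tail ind , dom′
      where
      dom′ : Dominating (suc m) (true ∷ S)
      dom′ zero 0∉ with () ← 0∉ here
      dom′ (suc i) i∉ = dominated-pred-out (dom (suc (suc i)) λ { (there i∈) → i∉ i∈ })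
    from : IndependentDominating (suc m) (true ∷ S) →
           IndependentDominating (suc (suc m)) (false ∷ true ∷ S)
    from (ind , dom) = independent-out ind , dom′
      where
      dom′ : Dominating (suc (suc m)) (false ∷ true ∷ S)
      dom′ zero _ = suc zero , there here , inj₁ refl
      dom′ (suc i) i∉ = dominated-suc (dom i λ i∈ → i∉ (there i∈))

IDSet : (m k : ℕ) → Subset m → Set
IDSet m k S = IndependentDominating m S × ∣ S ∣ ≡ k

idSet? : (m k : ℕ) → Decidable (IDSet m k)
idSet? m k S = (independent? m S ×-dec dominating? m S) ×-dec (∣ S ∣ ≟ k)

-- Independent dominating sets of P_(m+1) of size k containing, respectively
-- avoiding, vertex 0 (counted through their restriction to the other m vertices).
withFirst withoutFirst : ℕ → ℕ → ℕ
withFirst    m k = #subsets (idSet? (suc m) k ∘ (true ∷_))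
withoutFirst m k = #subsets (idSet? (suc m) k ∘ (false ∷_))

dᵢ-split : ∀ m k → dᵢ-path (suc m) k ≡ withFirst m k + withoutFirst m k
dᵢ-split m k = #subsets-split (idSet? (suc m) k)

-- A set containing vertex 0 is nonempty.
withFirst-zero : ∀ m → withFirst m 0 ≡ 0
withFirst-zero m = #subsets-none (idSet? (suc m) 0 ∘ (true ∷_)) λ { _ (_ , ()) }

-- withFirst (m+1) (k+1) = dᵢ(P_m, k): the second vertex must be unchosen
-- (¬both-first-two), and then first-chosen applies.
withFirst-suc : ∀ m k → withFirst (suc m) (suc k) ≡ dᵢ-path m k
withFirst-suc m k = begin
  withFirst (suc m) (suc k)
    ≡⟨ #subsets-split (idSet? (suc (suc m)) (suc k) ∘ (true ∷_)) ⟩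
  #subsets bothChosen + #subsets secondOmitted
    ≡⟨ cong₂ _+_ (#subsets-none bothChosen impossible) refl ⟩
  #subsets secondOmitted
    ≡⟨ #subsets-cong secondOmitted (idSet? m k) (to , from) ⟩
  dᵢ-path m k ∎
  where
  open ≡-Reasoning
  bothChosen : Decidable (λ S → IDSet (suc (suc m)) (suc k) (true ∷ true ∷ S))
  bothChosen = idSet? (suc (suc m)) (suc k) ∘ (true ∷_) ∘ (true ∷_)
  secondOmitted : Decidable (λ S → IDSet (suc (suc m)) (suc k) (true ∷ false ∷ S))
  secondOmitted = idSet? (suc (suc m)) (suc k) ∘ (true ∷_) ∘ (false ∷_)
  impossible : ∀ S → ¬ IDSet (suc (suc m)) (suc k) (true ∷ true ∷ S)
  impossible _ ((ind , _) , _) = ¬both-first-two ind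
  to : ∀ {S} → IDSet (suc (suc m)) (suc k) (true ∷ false ∷ S) → IDSet m k S
  to (isID , size) = Equivalence.to first-chosen isID , suc-injective size
  from : ∀ {S} → IDSet m k S → IDSet (suc (suc m)) (suc k) (true ∷ false ∷ S)
  from (isID , size) = Equivalence.from first-chosen isID , cong suc size

-- withoutFirst (m+1) k = withFirst m k: the second vertex must be chosen
-- (¬neither-first-two), and then first-omitted applies.
withoutFirst-suc : ∀ m k → withoutFirst (suc m) k ≡ withFirst m k
withoutFirst-suc m k = begin
  withoutFirst (suc m) k
    ≡⟨ #subsets-split (idSet? (suc (suc m)) k ∘ (false ∷_)) ⟩
  #subsets secondChosen + #subsets neitherChosen
    ≡⟨ cong₂ _+_ refl (#subsets-none neitherChosen impossible) ⟩
  #subsets secondChosen + 0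
    ≡⟨ +-identityʳ _ ⟩
  #subsets secondChosen
    ≡⟨ #subsets-cong secondChosen (idSet? (suc m) k ∘ (true ∷_)) (to , from) ⟩
  withFirst m k ∎
  where
  open ≡-Reasoning
  secondChosen : Decidable (λ S → IDSet (suc (suc m)) k (false ∷ true ∷ S))
  secondChosen = idSet? (suc (suc m)) k ∘ (false ∷_) ∘ (true ∷_)
  neitherChosen : Decidable (λ S → IDSet (suc (suc m)) k (false ∷ false ∷ S))
  neitherChosen = idSet? (suc (suc m)) k ∘ (false ∷_) ∘ (false ∷_)
  impossible : ∀ S → ¬ IDSet (suc (suc m)) k (false ∷ false ∷ S)
  impossible _ ((_ , dom) , _) = ¬neither-first-two dom
  to : ∀ {S} → IDSet (suc (suc m)) k (false ∷ true ∷ S) → IDSet (suc m) k (true ∷ S)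
  to (isID , size) = Equivalence.to first-omitted isID , size
  from : ∀ {S} → IDSet (suc m) k (true ∷ S) → IDSet (suc (suc m)) k (false ∷ true ∷ S)
  from (isID , size) = Equivalence.from first-omitted isID , size

-- No nonempty path has the empty set as a dominating set.
withoutFirst-zero : ∀ m → withoutFirst m 0 ≡ 0
withoutFirst-zero zero    = refl
withoutFirst-zero (suc m) = trans (withoutFirst-suc m 0) (withFirst-zero m)

binomℤ-pascal : ∀ n a b →
  binomℤ n (a ⊖ b) + binomℤ n (a ⊖ suc b) ≡ binomℤ (suc n) (a ⊖ b)
binomℤ-pascal n zero    zero    = refl
binomℤ-pascal n zero    (suc b) = refl
binomℤ-pascal n (suc a) zero    rewrite [1+m]⊖[1+n]≡m⊖n a 0 =
  trans (+-comm (n C suc a) (n C a)) (nCk+nC[k+1]≡[n+1]C[k+1] n a)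
binomℤ-pascal n (suc a) (suc b)
  rewrite [1+m]⊖[1+n]≡m⊖n a b | [1+m]⊖[1+n]≡m⊖n a (suc b) = binomℤ-pascal n a b

shift-index : ∀ m k → suc (suc m) ⊖ (suc k + suc k) ≡ m ⊖ (k + k)
shift-index m k = begin
  suc (suc m) ⊖ suc (k + suc k) ≡⟨ [1+m]⊖[1+n]≡m⊖n (suc m) (k + suc k) ⟩
  suc m ⊖ (k + suc k)           ≡⟨ cong (suc m ⊖_) (+-suc k k) ⟩
  suc m ⊖ suc (k + k)           ≡⟨ [1+m]⊖[1+n]≡m⊖n m (k + k) ⟩
  m ⊖ (k + k)                   ∎
  where open ≡-Reasoning

mutual
  dᵢ-closed : ∀ m k → dᵢ-path m k ≡ binomℤ (suc k) (suc m ⊖ (k + k))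
  dᵢ-closed zero    zero    = refl
  dᵢ-closed zero    (suc k) rewrite +-suc k k = refl
  dᵢ-closed (suc m) zero    = begin
    dᵢ-path (suc m) 0                ≡⟨ dᵢ-split m 0 ⟩
    withFirst m 0 + withoutFirst m 0 ≡⟨ cong₂ _+_ (withFirst-zero m) refl ⟩
    withoutFirst m 0                 ≡⟨ withoutFirst-zero m ⟩
    0                                ∎
    where open ≡-Reasoning
  dᵢ-closed (suc m) (suc k) = begin
    dᵢ-path (suc m) (suc k)
      ≡⟨ dᵢ-split m (suc k) ⟩
    withFirst m (suc k) + withoutFirst m (suc k)
      ≡⟨ cong₂ _+_ (withFirst-closed m k) refl ⟩
    binomℤ (suc k) (m ⊖ (k + k)) + withoutFirst m (suc k)
      ≡⟨ cong₂ _+_ refl (withoutFirst-closed m k) ⟩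
    binomℤ (suc k) (m ⊖ (k + k)) + binomℤ (suc k) (m ⊖ suc (k + k))
      ≡⟨ binomℤ-pascal (suc k) m (k + k) ⟩
    binomℤ (suc (suc k)) (m ⊖ (k + k))
      ≡⟨ cong (binomℤ (suc (suc k))) (sym (shift-index m k)) ⟩
    binomℤ (suc (suc k)) (suc (suc m) ⊖ (suc k + suc k)) ∎
    where open ≡-Reasoning

  withFirst-closed : ∀ m k → withFirst m (suc k) ≡ binomℤ (suc k) (m ⊖ (k + k))
  withFirst-closed zero    zero    = refl
  withFirst-closed zero    (suc k) = refl
  withFirst-closed (suc m) k       = trans (withFirst-suc m k) (dᵢ-closed m k)

  withoutFirst-closed : ∀ m k → withoutFirst m (suc k) ≡ binomℤ (suc k) (m ⊖ suc (k + k))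
  withoutFirst-closed zero    k = refl
  withoutFirst-closed (suc m) k = begin
    withoutFirst (suc m) (suc k)        ≡⟨ withoutFirst-suc m (suc k) ⟩
    withFirst m (suc k)                 ≡⟨ withFirst-closed m k ⟩
    binomℤ (suc k) (m ⊖ (k + k))
      ≡⟨ cong (binomℤ (suc k)) (sym ([1+m]⊖[1+n]≡m⊖n m (k + k))) ⟩
    binomℤ (suc k) (suc m ⊖ suc (k + k)) ∎
    where open ≡-Reasoning

lower-index : ∀ k t → suc (k + t) ⊖ (k + k) ≡ (+ t) - (+ k) +ℤ + 1
lower-index k t = begin
  suc (k + t) ⊖ (k + k)  ≡⟨ cong (_⊖ (k + k)) (sym (+-suc k t)) ⟩
  (k + suc t) ⊖ (k + k)  ≡⟨ +-cancelˡ-⊖ k (suc t) k ⟩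
  suc t ⊖ k              ≡⟨ cong (_⊖ k) (+-comm 1 t) ⟩
  (t + 1) ⊖ k            ≡⟨ sym (distribˡ-⊖-+-pos 1 t k) ⟩
  (t ⊖ k) +ℤ + 1         ≡⟨ cong (_+ℤ + 1) (sym (m-n≡m⊖n t k)) ⟩
  (+ t) - (+ k) +ℤ + 1   ∎
  where open ≡-Reasoning

-- The closed form holds for every k.
mainTheorem12 : (k t : ℕ) → 1 ≤ k →
    dᵢ-path (k + t) k ≡ binomℤ (suc k) ((+ t) - (+ k) +ℤ + 1)
mainTheorem12 k t _ = trans (dᵢ-closed (k + t) k) (cong (binomℤ (suc k)) (lower-index k t))
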